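{- For integers $n\ge1$ and $k\ge2$, $2T_n(k)-T_{n-1}(k+1)=\binom{n+2k-1}{k}$.
   Context: For integers $n\ge0$, $k\ge0$, $T_n(k)=\sum_{i=1}^{n}2^{i-1}\binom{n+2k-i-1}{k-1}$ (so $T_0(k)=0$), where binomial coefficients with negative lower index are $0$. -}

module Defs where

open import Data.Nat using (ℕ; zero; suc; _+_; _*_; _∸_; _^_)
open import Data.Nat.Combinatorics using (_C_)

-- Binomial with lower index k-1 (zero when k = 0, i.e. lower index negative):
-- binomPred m k = C(m, k-1)
binomPred : ℕ → ℕ → ℕ
binomPred m zero    = 0
binomPred m (suc j) = m C j

-- summand for index i (1 ≤ i ≤ n): 2^(i-1) * C(n+2k-i-1, k-1)
-- for i ≤ n and k ≥ 1 the upper index n+2k-i-1 is a natural number, so ∸ is exact;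
-- for k = 0 the binomial is 0 regardless.
term : ℕ → ℕ → ℕ → ℕ
term n k i = 2 ^ (i ∸ 1) * binomPred (n + 2 * k ∸ i ∸ 1) k

sumFrom1 : ℕ → (ℕ → ℕ) → ℕ
sumFrom1 zero    f = 0
sumFrom1 (suc m) f = sumFrom1 m f + f (suc m)

T : ℕ → ℕ → ℕ
T n k = sumFrom1 n (term n k)

-- Peeling off the summand i = 1 and shifting the index exhibits the recurrence
-- T_{n+1}(k) = C(n+2k-1, k-1) + 2 T_n(k).  Induction on n then needs Pascal's rule
-- twice, and the base case n = 1 is the central-binomial identity
-- 2 C(2k-1, k-1) = C(2k, k).
module Submission where

open import Defs
open import Data.Nat using (ℕ; zero; suc; _+_; _*_; _∸_; _≤_; _^_)
open import Data.Nat.Combinatorics using (_C_; nCk+nC[k+1]≡[n+1]C[k+1]; nCk≡nC[n∸k])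
open import Data.Nat.Properties
  using (+-identityʳ; *-zeroʳ; +-assoc; *-identityˡ; *-assoc; *-distribˡ-+; *-suc; +-suc; m≤m+n; m+n∸m≡n)
open import Data.Nat.Tactic.RingSolver using (solve-∀)
open import Relation.Binary.PropositionalEquality using (_≡_; refl; sym; trans; cong; cong₂; module ≡-Reasoning)
open ≡-Reasoning

sumFrom1-suc : ∀ m f → sumFrom1 (suc m) f ≡ f 1 + sumFrom1 m (λ i → f (suc i))
sumFrom1-suc zero    f = sym (+-identityʳ (f 1))
sumFrom1-suc (suc m) f = begin
  sumFrom1 (suc m) f + f (suc (suc m))
    ≡⟨ cong (_+ f (suc (suc m))) (sumFrom1-suc m f) ⟩
  f 1 + sumFrom1 m (λ i → f (suc i)) + f (suc (suc m))
    ≡⟨ +-assoc (f 1) _ _ ⟩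
  f 1 + (sumFrom1 m (λ i → f (suc i)) + f (suc (suc m))) ∎

sumFrom1-cong : ∀ m {f g} → (∀ i → f (suc i) ≡ g (suc i)) → sumFrom1 m f ≡ sumFrom1 m g
sumFrom1-cong zero    f≗g = refl
sumFrom1-cong (suc m) f≗g = cong₂ _+_ (sumFrom1-cong m f≗g) (f≗g m)

*-distribˡ-sumFrom1 : ∀ c m f → c * sumFrom1 m f ≡ sumFrom1 m (λ i → c * f i)
*-distribˡ-sumFrom1 c zero    f = *-zeroʳ c
*-distribˡ-sumFrom1 c (suc m) f = trans (*-distribˡ-+ c (sumFrom1 m f) (f (suc m)))
  (cong (_+ c * f (suc m)) (*-distribˡ-sumFrom1 c m f))

T-suc : ∀ n k → T (suc n) k ≡ binomPred (n + 2 * k ∸ 1) k + 2 * T n k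
T-suc n k = begin
  T (suc n) k
    ≡⟨ sumFrom1-suc n (term (suc n) k) ⟩
  term (suc n) k 1 + sumFrom1 n (λ i → term (suc n) k (suc i))
    ≡⟨ cong₂ _+_ (*-identityˡ _) (sumFrom1-cong n (λ i → *-assoc 2 (2 ^ i) _)) ⟩
  binomPred (n + 2 * k ∸ 1) k + sumFrom1 n (λ i → 2 * term n k i)
    ≡⟨ cong (binomPred (n + 2 * k ∸ 1) k +_) (sym (*-distribˡ-sumFrom1 2 n (term n k))) ⟩
  binomPred (n + 2 * k ∸ 1) k + 2 * T n k ∎

[m+n]Cm≡[m+n]Cn : ∀ m n → (m + n) C m ≡ (m + n) C n
[m+n]Cm≡[m+n]Cn m n = trans (nCk≡nC[n∸k] (m≤m+n m n)) (cong ((m + n) C_) (m+n∸m≡n m n))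

2*[2m+1]Cm≡[2m+2]C[m+1] : ∀ m → 2 * ((m + suc m) C m) ≡ suc (m + suc m) C suc m
2*[2m+1]Cm≡[2m+2]C[m+1] m = begin
  2 * ((m + suc m) C m)
    ≡⟨ cong ((m + suc m) C m +_) (+-identityʳ ((m + suc m) C m)) ⟩
  (m + suc m) C m + (m + suc m) C m
    ≡⟨ cong ((m + suc m) C m +_) ([m+n]Cm≡[m+n]Cn m (suc m)) ⟩
  (m + suc m) C m + (m + suc m) C suc m
    ≡⟨ nCk+nC[k+1]≡[n+1]C[k+1] (m + suc m) m ⟩
  suc (m + suc m) C suc m ∎

2*T[1+n,1+j]≡T[n,2+j]+C : ∀ n j → 2 * T (suc n) (suc j) ≡ T n (suc (suc j)) + (n + 2 * suc j) C suc j
-- j + suc (j + 0) is the normal form of 2 * suc j ∸ 1.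
2*T[1+n,1+j]≡T[n,2+j]+C zero    j = begin
  2 * T 1 (suc j)
    ≡⟨ cong (2 *_) (*-identityˡ ((j + suc (j + 0)) C j)) ⟩
  2 * ((j + suc (j + 0)) C j)
    ≡⟨ cong (λ m → 2 * ((j + suc m) C j)) (+-identityʳ j) ⟩
  2 * ((j + suc j) C j)
    ≡⟨ 2*[2m+1]Cm≡[2m+2]C[m+1] j ⟩
  suc (j + suc j) C suc j
    ≡⟨ cong (λ m → suc (j + suc m) C suc j) (sym (+-identityʳ j)) ⟩
  T 0 (suc (suc j)) + (0 + 2 * suc j) C suc j ∎
2*T[1+n,1+j]≡T[n,2+j]+C (suc n) j = begin
  2 * T (suc (suc n)) k
    ≡⟨ cong (2 *_) (T-suc (suc n) k) ⟩
  2 * (a + 2 * T (suc n) k)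
    ≡⟨ cong (λ x → 2 * (a + x)) (2*T[1+n,1+j]≡T[n,2+j]+C n j) ⟩
  2 * (a + (T n (suc k) + b))
    ≡⟨ regroup a b (T n (suc k)) ⟩
  (a + b + 2 * T n (suc k)) + (a + b)
    ≡⟨ cong₂ _+_ (cong (_+ 2 * T n (suc k)) pascal′) pascal ⟩
  (binomPred (n + 2 * suc k ∸ 1) (suc k) + 2 * T n (suc k)) + suc (n + 2 * k) C k
    ≡⟨ cong (_+ suc (n + 2 * k) C k) (sym (T-suc n (suc k))) ⟩
  T (suc n) (suc k) + suc (n + 2 * k) C k ∎
  where
  k a b : ℕ
  k = suc j
  a = (n + 2 * k) C j
  b = (n + 2 * k) C k
  regroup : ∀ a b t → 2 * (a + (t + b)) ≡ (a + b + 2 * t) + (a + b)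
  regroup = solve-∀
  pascal : a + b ≡ suc (n + 2 * k) C k
  pascal = nCk+nC[k+1]≡[n+1]C[k+1] (n + 2 * k) j
  index : n + 2 * suc k ∸ 1 ≡ suc (n + 2 * k)
  index = begin
    n + 2 * suc k ∸ 1         ≡⟨ cong (λ x → n + x ∸ 1) (*-suc 2 k) ⟩
    n + suc (suc (2 * k)) ∸ 1 ≡⟨ cong (_∸ 1) (+-suc n (suc (2 * k))) ⟩
    n + suc (2 * k)           ≡⟨ +-suc n (2 * k) ⟩
    suc (n + 2 * k)           ∎
  pascal′ : a + b ≡ binomPred (n + 2 * suc k ∸ 1) (suc k)
  pascal′ = trans pascal (cong (_C k) (sym index))

-- The identity already holds for k ≥ 1.
lemma5 : ∀ (n k : ℕ) → 1 ≤ n → 2 ≤ k →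
    2 * T n k ≡ T (n ∸ 1) (suc k) + (n + 2 * k ∸ 1) C k
lemma5 (suc n) (suc j) _ _ = 2*T[1+n,1+j]≡T[n,2+j]+C n j
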